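{- Let $G$ be a connected graph, $m \in \mathbb{N}$, and let $\mathcal{H}=(L,H)$ be an $m$-fold cover of $G$ that has a canonical labeling, so $L(v)=\{(v,j): j\in[m]\}$ for each $v \in V(G)$. For each $i \in [m]$ let $B_i = \{(v,i) : v \in V(G)\}$. Then a set $I \subseteq V(H)$ satisfies both $|I \cap L(v)| = 1$ for every $v \in V(G)$ and $H[I]$ is isomorphic to $G$ if and only if $I = B_j$ for some $j \in [m]$.
   Context: All graphs are finite and simple; $[m]=\{1,\dots,m\}$. A cover of a graph $G$ is a pair $\mathcal{H}=(L,H)$ where $H$ is a graph and $L: V(G) \to \mathcal{P}(V(H))$ satisfies: (1) $\{L(u): u \in V(G)\}$ is a partition of $V(H)$; (2) for every $u$, $H[L(u)]$ is complete; (3) if $E_H(L(u),L(v))$ is nonempty then $u=v$ or $uv \in E(G)$; (4) if $uv \in E(G)$, then $E_H(L(u),L(v))$ is a matching. Here $E_H(S,U)$ is the set of edges of $H$ with one endpoint in $S$ and one in $U$. It is $m$-fold if $|L(u)|=m$ for all $u$. An $m$-fold cover has a canonical labeling if the vertices of $H$ can be named so that $L(u)=\{(u,j): j \in [m]\}$ for each $u \in V(G)$ and $(u,j)(v,j) \in E(H)$ for each $j \in [m]$ whenever $uv \in E(G)$. -}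

module Defs where

open import Level using (0ℓ)
open import Data.Nat using (ℕ)
open import Data.Fin using (Fin)
open import Data.Bool using (Bool; true)
open import Data.Product using (Σ; _×_; _,_; proj₁)
open import Relation.Binary.PropositionalEquality using (_≡_; _≢_)
open import Relation.Nullary using (¬_)
open import Function.Bundles using (_⤖_; _⇔_; Bijection)

record Graph (n : ℕ) : Set₁ where
  field
    Adj     : Fin n → Fin n → Set
    sym     : ∀ {u v} → Adj u v → Adj v u
    irrefl  : ∀ {u} → ¬ Adj u u
open Graph public

data Reachable {n : ℕ} (G : Graph n) : Fin n → Fin n → Set where
  here : ∀ {u} → Reachable G u u
  step : ∀ {u v w} → Adj G u v → Reachable G v w → Reachable G u w

Connected : {n : ℕ} → Graph n → Set
Connected {n} G = ∀ (u v : Fin n) → Reachable G u v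

-- An m-fold cover (L, H) of G with a canonical labeling: the vertices of H are
-- named (u , j) with u ∈ V(G), j ∈ [m] (here Fin m), L(u) = {(u , j) : j},
-- so {L u} is automatically a partition of V(H) with |L u| = m.
record CanonicalCover {n : ℕ} (G : Graph n) (m : ℕ) : Set₁ where
  field
    HAdj      : Fin n × Fin m → Fin n × Fin m → Set
    Hsym      : ∀ {x y} → HAdj x y → HAdj y x
    Hirrefl   : ∀ {x} → ¬ HAdj x x
    complete  : ∀ u i j → i ≢ j → HAdj (u , i) (u , j)
    respects  : ∀ u v i j → u ≢ v → HAdj (u , i) (v , j) → Adj G u v
    matching  : ∀ u v → Adj G u v → ∀ i j k →
                HAdj (u , i) (v , j) → HAdj (u , i) (v , k) → j ≡ k
    canonical : ∀ u v → Adj G u v → ∀ j → HAdj (u , j) (v , j)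
open CanonicalCover public

VSubset : ℕ → ℕ → Set
VSubset n m = Fin n → Fin m → Bool

_∈ᴵ_ : ∀ {n m} → Fin n × Fin m → VSubset n m → Set
(u , j) ∈ᴵ I = I u j ≡ true

ExactlyOneIn : ∀ {n m} → VSubset n m → Fin n → Set
ExactlyOneIn {n} {m} I v = Σ (Fin m) λ j → ((v , j) ∈ᴵ I) × (∀ k → (v , k) ∈ᴵ I → k ≡ j)

InducedV : ∀ {n m} → VSubset n m → Set
InducedV {n} {m} I = Σ (Fin n × Fin m) λ x → x ∈ᴵ I

InducedIsoToG : ∀ {n m} {G : Graph n} → CanonicalCover G m → VSubset n m → Set
InducedIsoToG {n} {m} {G} 𝓗 I =
  Σ (InducedV I ⤖ Fin n) λ f →
    ∀ (x y : InducedV I) →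
      HAdj 𝓗 (proj₁ x) (proj₁ y) ⇔ Adj G (Bijection.to f x) (Bijection.to f y)

IsB : ∀ {n m} → VSubset n m → Fin m → Set
IsB {n} {m} I j = ∀ (v : Fin n) (k : Fin m) → ((v , k) ∈ᴵ I) ⇔ (k ≡ j)

-- If I meets every fibre L(v) exactly once, write (v , σ v) for its point in L(v).  Composing
-- v ↦ (v , σ v) with the isomorphism H[I] ≅ G gives an injective self-map h of V(G), and since
-- edges of H project to edges of G, h reflects adjacency.  A permutation of a finite set has
-- its inverse among its powers, so h also preserves adjacency.  Hence every edge uv of G lifts
-- to an edge (u , σ u)(v , σ v) of H; the canonical edge (u , σ u)(v , σ u) and the matching
-- condition force σ u = σ v, and connectivity makes σ constant.
module Submission where

open import Defs hiding (sym)
open import Data.Nat using (ℕ; _≥_; zero; suc; _+_; _*_)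
open import Data.Nat.Properties using (*-comm; +-suc; n<1+n; m≤n⇒∃[o]m+o≡n)
open import Data.Fin using (Fin; toℕ; _≟_) renaming (zero to fzero)
open import Data.Fin.Properties using (pigeonhole)
import Data.Bool as Bool
open import Data.Product using (Σ; _×_; _,_; proj₁; proj₂; ∃)
open import Data.Empty using (⊥-elim)
open import Function.Base using (const)
open import Function.Bundles using (_⇔_; mk⇔; mk⤖; Bijection; Equivalence)
open import Function.Definitions using (Injective)
import Function.Endo.Propositional as Endo
open import Relation.Binary.Core using (Rel; _Preserves_⟶_)
open import Relation.Binary.PropositionalEquality
  using (_≡_; refl; sym; trans; cong; cong-app; subst; subst₂; module ≡-Reasoning)
open import Relation.Nullary using (yes; no)
open import Axiom.UniquenessOfIdentityProofs using (module Decidable⇒UIP)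

module _ {a} {A : Set a} where
  open Endo A using (_^_)

  ^-fixed-* : ∀ {f : A → A} {x p} → (f ^ p) x ≡ x → ∀ k → (f ^ (k * p)) x ≡ x
  ^-fixed-*             fᵖx≡x zero    = refl
  ^-fixed-* {f} {x} {p} fᵖx≡x (suc k) = begin
    (f ^ (p + k * p)) x       ≡⟨ cong-app (Endo.^-homo A f p (k * p)) x ⟩
    (f ^ p) ((f ^ (k * p)) x) ≡⟨ cong (f ^ p) (^-fixed-* fᵖx≡x k) ⟩
    (f ^ p) x                 ≡⟨ fᵖx≡x ⟩
    x                         ∎
    where open ≡-Reasoning

  ^-suc-reflects : ∀ {ℓ} (R : Rel A ℓ) {f : A → A} →
                   (∀ {x y} → R (f x) (f y) → R x y) →
                   ∀ k {x y} → R ((f ^ suc k) x) ((f ^ suc k) y) → R (f x) (f y)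
  ^-suc-reflects R reflects zero    r = r
  ^-suc-reflects R reflects (suc k) r = ^-suc-reflects R reflects k (reflects r)

module _ {n : ℕ} {h : Fin n → Fin n} (h-injective : Injective _≡_ _≡_ h) where
  open Endo (Fin n) using (_^_)

  ^-injective : ∀ k → Injective _≡_ _≡_ (h ^ k)
  ^-injective zero    eq = eq
  ^-injective (suc k) eq = ^-injective k (h-injective eq)

  ^-periodic : ∀ u → ∃ λ p → (h ^ suc p) u ≡ u
  ^-periodic u
    with i , j , i<j , hⁱu≡hʲu ← pigeonhole (n<1+n n) (λ i → (h ^ toℕ i) u)
    with p , i+1+p≡j ← m≤n⇒∃[o]m+o≡n i<j
    = p , sym (^-injective (toℕ i) (begin
        (h ^ toℕ i) u                 ≡⟨ hⁱu≡hʲu ⟩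
        (h ^ toℕ j) u                 ≡⟨ cong (λ k → (h ^ k) u) (trans (sym i+1+p≡j) (sym (+-suc (toℕ i) p))) ⟩
        (h ^ (toℕ i + suc p)) u       ≡⟨ cong-app (Endo.^-homo (Fin n) h (toℕ i) (suc p)) u ⟩
        (h ^ toℕ i) ((h ^ suc p) u)   ∎))
    where open ≡-Reasoning

  -- h ^ (1 + N), where 1 + N = (1 + p)(1 + q), fixes u and v, so h ^ N undoes h on them.
  reflects⇒preserves : ∀ {ℓ} (R : Rel (Fin n) ℓ) →
                       (∀ {u v} → R (h u) (h v) → R u v) → h Preserves R ⟶ R
  reflects⇒preserves R reflects {u} {v} r
    with p , hᵖ⁺¹u≡u ← ^-periodic u | q , hᵠ⁺¹v≡v ← ^-periodic v
    = ^-suc-reflects R reflects (q + p * suc q) (subst₂ R (sym period-u) (sym period-v) r)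
    where
      period-u : (h ^ (suc p * suc q)) u ≡ u
      period-u = subst (λ k → (h ^ k) u ≡ u) (*-comm (suc q) (suc p)) (^-fixed-* {f = h} {p = suc p} hᵖ⁺¹u≡u (suc q))
      period-v : (h ^ (suc p * suc q)) v ≡ v
      period-v = ^-fixed-* {f = h} {p = suc q} hᵠ⁺¹v≡v (suc p)

constant-on-Reachable : ∀ {n b} {B : Set b} {G : Graph n} (f : Fin n → B) →
                        (∀ {u v} → Adj G u v → f u ≡ f v) →
                        ∀ {u v} → Reachable G u v → f u ≡ f v
constant-on-Reachable f constant-on-edges here       = refl
constant-on-Reachable f constant-on-edges (step e r) =
  trans (constant-on-edges e) (constant-on-Reachable f constant-on-edges r)

module _ {n m : ℕ} {G : Graph n} (𝓗 : CanonicalCover G m) where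

  HAdj-section⇒Adj : ∀ (σ : Fin n → Fin m) u v → HAdj 𝓗 (u , σ u) (v , σ v) → Adj G u v
  HAdj-section⇒Adj σ u v e with u ≟ v
  ... | yes refl = ⊥-elim (Hirrefl 𝓗 e)
  ... | no u≢v   = respects 𝓗 u v (σ u) (σ v) u≢v e

  HAdj-layer⇔Adj : ∀ j u v → HAdj 𝓗 (u , j) (v , j) ⇔ Adj G u v
  HAdj-layer⇔Adj j u v = mk⇔ (HAdj-section⇒Adj (const j) u v) (λ e → canonical 𝓗 u v e j)

  HAdj-over-Adj⇒same-layer : ∀ {u v i j} → Adj G u v → HAdj 𝓗 (u , i) (v , j) → i ≡ j
  HAdj-over-Adj⇒same-layer {u} {v} {i} {j} e eᴴ =
    sym (matching 𝓗 u v e i j i eᴴ (canonical 𝓗 u v e i))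

module Transversal {n m : ℕ} {G : Graph n} (𝓗 : CanonicalCover G m) (I : VSubset n m)
                   (transversal : ∀ v → ExactlyOneIn I v) where

  choice : Fin n → Fin m
  choice v = proj₁ (transversal v)

  section : Fin n → InducedV I
  section v = (v , choice v) , proj₁ (proj₂ (transversal v))

  choice-constant⇒IsB : ∀ j → (∀ v → choice v ≡ j) → IsB I j
  choice-constant⇒IsB j choice≡j v k = mk⇔
    (λ vk∈I → trans (proj₂ (proj₂ (transversal v)) k vk∈I) (choice≡j v))
    (λ { refl → subst (λ k → (v , k) ∈ᴵ I) (choice≡j v) (proj₁ (proj₂ (transversal v))) })

  choice-constant-on-edges : InducedIsoToG 𝓗 I → ∀ {u v} → Adj G u v → choice u ≡ choice v
  choice-constant-on-edges (f , adj⇔) {u} {v} e =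
    HAdj-over-Adj⇒same-layer 𝓗 e (Equivalence.from (adj⇔ (section u) (section v)) (h-preserves e))
    where
      h : Fin n → Fin n
      h v = Bijection.to f (section v)

      h-injective : Injective _≡_ _≡_ h
      h-injective eq = cong (λ x → proj₁ (proj₁ x)) (Bijection.injective f eq)

      h-reflects : ∀ {u v} → Adj G (h u) (h v) → Adj G u v
      h-reflects {u} {v} eʰ =
        HAdj-section⇒Adj 𝓗 choice u v (Equivalence.from (adj⇔ (section u) (section v)) eʰ)

      h-preserves : h Preserves Adj G ⟶ Adj G
      h-preserves = reflects⇒preserves h-injective (Adj G) h-reflects

module Layer {n m : ℕ} {G : Graph n} (𝓗 : CanonicalCover G m) (I : VSubset n m)
             (j : Fin m) (isB : IsB I j) where

  ∈ᴵ⇒layer : ∀ {v k} → (v , k) ∈ᴵ I → k ≡ j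
  ∈ᴵ⇒layer {v} {k} = Equivalence.to (isB v k)

  layer⊆I : ∀ v → (v , j) ∈ᴵ I
  layer⊆I v = Equivalence.from (isB v j) refl

  transversal : ∀ v → ExactlyOneIn I v
  transversal v = j , layer⊆I v , λ k → ∈ᴵ⇒layer

  project : InducedV I → Fin n
  project ((v , _) , _) = v

  project-injective : Injective _≡_ _≡_ project
  project-injective {(u , k) , p} {(.u , k′) , p′} refl
    with refl ← ∈ᴵ⇒layer p
    with refl ← ∈ᴵ⇒layer p′
    with refl ← Decidable⇒UIP.≡-irrelevant Bool._≟_ p p′
    = refl

  induced≅G : InducedIsoToG 𝓗 I
  induced≅G = mk⤖ (project-injective , λ v → ((v , j) , layer⊆I v) , λ { refl → refl })
            , λ { ((u , k) , p) ((v , k′) , p′) → HAdj⇔Adj (∈ᴵ⇒layer p) (∈ᴵ⇒layer p′) }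
    where
      HAdj⇔Adj : ∀ {u v k k′} → k ≡ j → k′ ≡ j → HAdj 𝓗 (u , k) (v , k′) ⇔ Adj G u v
      HAdj⇔Adj refl refl = HAdj-layer⇔Adj 𝓗 j _ _

proposition12 : ∀ {n : ℕ} (G : Graph n) → n ≥ 1 → Connected G →
    ∀ (m : ℕ) (𝓗 : CanonicalCover G m) (I : VSubset n m) →
    ((∀ (v : Fin n) → ExactlyOneIn I v) × InducedIsoToG 𝓗 I) ⇔ Σ (Fin m) (IsB I)
proposition12 {suc n} G _ connected m 𝓗 I = mk⇔ transversal⇒IsB IsB⇒transversal
  where
    transversal⇒IsB : ((∀ v → ExactlyOneIn I v) × InducedIsoToG 𝓗 I) → Σ (Fin m) (IsB I)
    transversal⇒IsB (transversal , iso) =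
      choice fzero , choice-constant⇒IsB (choice fzero) λ v →
        constant-on-Reachable choice (choice-constant-on-edges iso) (connected v fzero)
      where open Transversal 𝓗 I transversal

    IsB⇒transversal : Σ (Fin m) (IsB I) → (∀ v → ExactlyOneIn I v) × InducedIsoToG 𝓗 I
    IsB⇒transversal (j , isB) = transversal , induced≅G
      where open Layer 𝓗 I j isB
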